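{- Let $d \ge 2$ be an integer and $\varepsilon > 0$. Then there exists $n_0 = n_0(d,\varepsilon)$ such that for every integer $n \ge n_0$ the $d$-dimensional unit cube $[0,1]^d$ can be decomposed into exactly $n$ smaller cubes in such a way that: - the ratio of the largest side length among these cubes to the smallest one is at most $1+\varepsilon$; - the cubes have at most $d+2$ different side lengths.
   Context: A decomposition (tiling) of a cube $C$ into cubes is a finite collection of $d$-dimensional cubes with pairwise disjoint interiors whose union is $C$.
   Formalization: The parameter ε ranges over the positive rationals, and the cubes of the decomposition have corners and side lengths taken in the rationals. -}

module Defs where

open import Data.Nat using (ℕ; suc; _+_)
open import Data.Fin using (Fin)
open import Data.Rational using (ℚ; 0ℚ; 1ℚ; _≤_; _<_) renaming (_+_ to _+ℚ_; _*_ to _*ℚ_)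
open import Data.Product using (Σ; _×_; ∃)
open import Relation.Binary.PropositionalEquality using (_≡_; _≢_)
open import Relation.Nullary using (¬_)

Point : ℕ → Set
Point d = Fin d → ℚ

-- A closed axis-parallel d-dimensional cube  ∏ᵢ [corner i, corner i + side]
-- with positive side length (rational coordinates).
record Cube (d : ℕ) : Set where
  constructor cube
  field
    corner : Point d
    side   : ℚ
    side>0 : 0ℚ < side
open Cube public

_∈C_ : ∀ {d} → Point d → Cube d → Set
x ∈C Q = ∀ i → (corner Q i ≤ x i) × (x i ≤ corner Q i +ℚ side Q)

_∈int_ : ∀ {d} → Point d → Cube d → Set
x ∈int Q = ∀ i → (corner Q i < x i) × (x i < corner Q i +ℚ side Q)

InUnitCube : ∀ {d} → Point d → Set
InUnitCube x = ∀ i → (0ℚ ≤ x i) × (x i ≤ 1ℚ)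

SubUnitCube : ∀ {d} → Cube d → Set
SubUnitCube Q = ∀ i → (0ℚ ≤ corner Q i) × (corner Q i +ℚ side Q ≤ 1ℚ)

IsDecomposition : ∀ {d n} → (Fin n → Cube d) → Set
IsDecomposition {d} {n} T =
  (∀ j → SubUnitCube (T j)) ×
  (∀ (x : Point d) → InUnitCube x → ∃ λ j → x ∈C T j) ×
  (∀ (j k : Fin n) → j ≢ k → ¬ (∃ λ (x : Point d) → (x ∈int T j) × (x ∈int T k)))

RatioBounded : ∀ {d n} → ℚ → (Fin n → Cube d) → Set
RatioBounded ε T = ∀ j k → side (T j) ≤ (1ℚ +ℚ ε) *ℚ side (T k)

AtMostSides : ∀ {d n} → ℕ → (Fin n → Cube d) → Set
AtMostSides {d} {n} m T =
  Σ (Fin m → ℚ) λ L → (∀ j → ∃ λ (a : Fin m) → side (T j) ≡ L a)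

{-# OPTIONS --safe #-}
module Submission where

-- Let m = (a + 1)^d - a^d. A cell cut into m×…×m subcells, each of them cut into
-- a^d or (a + 1)^d equal cubes, holds (m a)^d + j m cubes for any 0 ≤ j ≤ m^d; a cell cut into
-- (m a + 1)^d equal cubes holds (m a)^d + v cubes, where v ≡ 1 (mod m). A k×…×k grid of such cells, β of
-- them of the second kind, thus holds k^d (m a)^d + β v + α m cubes for any β ≤ k^d and α ≤ (k^d - β) m^d.
-- Taking k with k^d (m a)^d + m v ≤ n < (k + 1)^d (m a)^d + m v and β < m with β ≡ n (mod m) reaches
-- every large n. The side lengths are 1/(k m a), 1/(k m (a + 1)) and 1/(k (m a + 1)), so their ratio is
-- at most (a + 1)/a ≤ 1 + ε.

open import Defs
open import Data.Nat using (ℕ; zero; suc; pred; _+_; _*_; _^_; _∸_; _⊓_; _≤_; _<_; _≤?_; s≤s; z≤n; NonZero; >-nonZero)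
import Data.Nat.Properties as ℕₚ
import Data.Nat.Coprimality as ℕᶜ
open import Data.Nat.DivMod using (_%_; _/_; m≡m%n+[m/n]*n; %-distribˡ-*; m%n%n≡m%n; m%n<n; [m+kn]%n≡m%n)
open import Data.Nat.ListAction using (sum)
import Data.Nat.ListAction.Properties as Sumₚ
import Data.Nat.Solver as ℕ-Solver
import Data.Integer as ℤ
import Data.Integer.Solver as ℤ-Solver
open import Data.Rational as ℚ using (ℚ; 0ℚ; 1ℚ; mkℚ; toℚᵘ; 1/_; -_)
  renaming (_+_ to _+ℚ_; _-_ to _-ℚ_; _*_ to _*ℚ_; _≤_ to _≤ℚ_; _<_ to _<ℚ_)
import Data.Rational.Properties as ℚₚ
import Data.Rational.Unnormalised as ℚᵘ
import Data.Rational.Unnormalised.Properties as ℚᵘₚ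
import Data.Rational.Solver as ℚ-Solver
open import Data.Fin as Fin using (Fin; toℕ)
import Data.Fin.Properties as Finₚ
open import Data.Vec using (Vec; []; _∷_; lookup; tabulate)
import Data.Vec.Properties as Vecₚ
open import Data.List as List using (List; []; _∷_; _++_; map; concatMap; zip; length; replicate; allFin; cartesianProductWith)
import Data.List.Properties as Listₚ
open import Data.List.Relation.Unary.All as All using (All; []; _∷_)
import Data.List.Relation.Unary.All.Properties as Allₚ
open import Data.List.Relation.Unary.Any as Any using (Any; here; there)
import Data.List.Relation.Unary.Any.Properties as Anyₚ
open import Data.List.Relation.Unary.AllPairs as AllPairs using (AllPairs; []; _∷_)
import Data.List.Relation.Unary.AllPairs.Properties as AllPairsₚ
open import Data.List.Relation.Unary.Unique.Propositional using (Unique)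
import Data.List.Relation.Unary.Unique.Propositional.Properties as Uniqueₚ
open import Data.List.Membership.Propositional using (_∈_; lose)
import Data.List.Membership.Propositional.Properties as ∈ₚ
open import Data.Product using (Σ; _×_; _,_; proj₁; proj₂; ∃)
open import Function.Base using (_∘_; _on_; id)
open import Function.Bundles using (_⇔_; mk⇔; Equivalence)
open import Relation.Binary.Definitions using (Symmetric)
open import Relation.Binary.PropositionalEquality
open import Relation.Nullary using (¬_; yes; no; contradiction)
open import Relation.Unary using (Decidable)

open Equivalence using (to; from)

-- Abstract, like 1/[1+_] below: only the stated equations are used, and unfolding the rational
-- arithmetic defeats unification and instance search.
abstract
  fromℕ : ℕ → ℚ
  fromℕ zero    = 0ℚ
  fromℕ (suc n) = 1ℚ +ℚ fromℕ n

  fromℕ-zero : fromℕ zero ≡ 0ℚ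
  fromℕ-zero = refl

  fromℕ-suc : ∀ n → fromℕ (suc n) ≡ 1ℚ +ℚ fromℕ n
  fromℕ-suc n = refl

fromℕ-+ : ∀ m n → fromℕ (m + n) ≡ fromℕ m +ℚ fromℕ n
fromℕ-+ zero    n = begin
  fromℕ n            ≡⟨ ℚₚ.+-identityˡ (fromℕ n) ⟨
  0ℚ +ℚ fromℕ n      ≡⟨ cong (_+ℚ fromℕ n) fromℕ-zero ⟨
  fromℕ 0 +ℚ fromℕ n ∎
  where open ≡-Reasoning
fromℕ-+ (suc m) n = begin
  fromℕ (suc (m + n))            ≡⟨ fromℕ-suc (m + n) ⟩
  1ℚ +ℚ fromℕ (m + n)            ≡⟨ cong (1ℚ +ℚ_) (fromℕ-+ m n) ⟩
  1ℚ +ℚ (fromℕ m +ℚ fromℕ n)     ≡⟨ ℚₚ.+-assoc 1ℚ (fromℕ m) (fromℕ n) ⟨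
  (1ℚ +ℚ fromℕ m) +ℚ fromℕ n     ≡⟨ cong (_+ℚ fromℕ n) (fromℕ-suc m) ⟨
  fromℕ (suc m) +ℚ fromℕ n       ∎
  where open ≡-Reasoning

fromℕ-* : ∀ m n → fromℕ (m * n) ≡ fromℕ m *ℚ fromℕ n
fromℕ-* zero    n = begin
  fromℕ 0              ≡⟨ fromℕ-zero ⟩
  0ℚ                   ≡⟨ ℚₚ.*-zeroˡ (fromℕ n) ⟨
  0ℚ *ℚ fromℕ n        ≡⟨ cong (_*ℚ fromℕ n) fromℕ-zero ⟨
  fromℕ 0 *ℚ fromℕ n   ∎
  where open ≡-Reasoning
fromℕ-* (suc m) n = begin
  fromℕ (n + m * n)                   ≡⟨ fromℕ-+ n (m * n) ⟩
  fromℕ n +ℚ fromℕ (m * n)            ≡⟨ cong (fromℕ n +ℚ_) (fromℕ-* m n) ⟩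
  fromℕ n +ℚ fromℕ m *ℚ fromℕ n       ≡⟨ solve 2 (λ x y → y :+ x :* y := (con 1ℚ :+ x) :* y) refl (fromℕ m) (fromℕ n) ⟩
  (1ℚ +ℚ fromℕ m) *ℚ fromℕ n          ≡⟨ cong (_*ℚ fromℕ n) (fromℕ-suc m) ⟨
  fromℕ (suc m) *ℚ fromℕ n            ∎
  where
  open ≡-Reasoning
  open ℚ-Solver.+-*-Solver

fromℕ-nonNeg : ∀ n → 0ℚ ≤ℚ fromℕ n
fromℕ-nonNeg zero    = ℚₚ.≤-reflexive (sym fromℕ-zero)
fromℕ-nonNeg (suc n) = subst (0ℚ ≤ℚ_) (sym (fromℕ-suc n))
  (ℚₚ.+-mono-≤ (ℚₚ.<⇒≤ (ℚₚ.positive⁻¹ 1ℚ)) (fromℕ-nonNeg n))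

instance
  fromℕ-nonNegative : ∀ {n} → ℚ.NonNegative (fromℕ n)
  fromℕ-nonNegative {n} = ℚ.nonNegative (fromℕ-nonNeg n)

fromℕ-mono-≤ : ∀ {m n} → m ≤ n → fromℕ m ≤ℚ fromℕ n
fromℕ-mono-≤ {n = n} z≤n = subst (_≤ℚ fromℕ n) (sym fromℕ-zero) (fromℕ-nonNeg n)
fromℕ-mono-≤ {suc m} {suc n} (s≤s m≤n) = subst₂ _≤ℚ_ (sym (fromℕ-suc m)) (sym (fromℕ-suc n))
  (ℚₚ.+-monoʳ-≤ 1ℚ (fromℕ-mono-≤ m≤n))

fromℕ-<-suc : ∀ n → fromℕ n <ℚ fromℕ (suc n)
fromℕ-<-suc n = subst₂ _<ℚ_ (ℚₚ.+-identityˡ (fromℕ n)) (sym (fromℕ-suc n))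
  (ℚₚ.+-monoˡ-< (fromℕ n) (ℚₚ.positive⁻¹ 1ℚ))

fromℕ-cancel-< : ∀ {m n} → fromℕ m <ℚ fromℕ n → m < n
fromℕ-cancel-< {m} {n} fm<fn with m ℕₚ.<? n
... | yes m<n = m<n
... | no  m≮n = contradiction (ℚₚ.<-≤-trans fm<fn (fromℕ-mono-≤ (ℕₚ.≮⇒≥ m≮n))) (ℚₚ.<-irrefl refl)

fromℕ-pos : ∀ n → 0ℚ <ℚ fromℕ (suc n)
fromℕ-pos n = ℚₚ.≤-<-trans (fromℕ-nonNeg n) (fromℕ-<-suc n)

toℚᵘ-fromℕ : ∀ n → toℚᵘ (fromℕ n) ℚᵘ.≃ ℚᵘ.mkℚᵘ (ℤ.+ n) 0
toℚᵘ-fromℕ zero    = ℚᵘₚ.≃-reflexive (cong toℚᵘ fromℕ-zero)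
toℚᵘ-fromℕ (suc n) = begin
  toℚᵘ (fromℕ (suc n))           ≈⟨ ℚᵘₚ.≃-reflexive (cong toℚᵘ (fromℕ-suc n)) ⟩
  toℚᵘ (1ℚ +ℚ fromℕ n)           ≈⟨ ℚₚ.toℚᵘ-homo-+ 1ℚ (fromℕ n) ⟩
  ℚᵘ.1ℚᵘ ℚᵘ.+ toℚᵘ (fromℕ n)     ≈⟨ ℚᵘₚ.+-congʳ ℚᵘ.1ℚᵘ (toℚᵘ-fromℕ n) ⟩
  ℚᵘ.1ℚᵘ ℚᵘ.+ ℚᵘ.mkℚᵘ (ℤ.+ n) 0
    ≈⟨ ℚᵘ.*≡* (solve 1 (λ k → (con (ℤ.+ 1) :* con (ℤ.+ 1) :+ k :* con (ℤ.+ 1)) :* con (ℤ.+ 1)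
                             := (con (ℤ.+ 1) :+ k) :* con (ℤ.+ 1)) refl (ℤ.+ n)) ⟩
  ℚᵘ.mkℚᵘ (ℤ.+ suc n) 0         ∎
  where
  open ℚᵘₚ.≃-Reasoning
  open ℤ-Solver.+-*-Solver

fromℕ≡mkℚ : ∀ n → fromℕ n ≡ mkℚ (ℤ.+ n) 0 (ℕᶜ.sym (ℕᶜ.1-coprimeTo n))
fromℕ≡mkℚ n = ℚₚ.toℚᵘ-injective (toℚᵘ-fromℕ n)

abstract
  fromℕ-suc-nonZero : ∀ n → ℚ.NonZero (fromℕ (suc n))
  fromℕ-suc-nonZero n = ℚₚ.pos⇒nonZero (fromℕ (suc n)) {{ℚ.positive (fromℕ-pos n)}}

  1/[1+_] : ℕ → ℚ
  1/[1+ g ] = (1/ fromℕ (suc g)) {{fromℕ-suc-nonZero g}}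

  instance
    1/[1+]-positive : ∀ {g} → ℚ.Positive 1/[1+ g ]
    1/[1+]-positive {g} = ℚₚ.1/pos⇒pos (fromℕ (suc g)) {{ℚ.positive (fromℕ-pos g)}}

  1/[1+]-inverse : ∀ g → 1/[1+ g ] *ℚ fromℕ (suc g) ≡ 1ℚ
  1/[1+]-inverse g = ℚₚ.*-inverseˡ (fromℕ (suc g)) {{fromℕ-suc-nonZero g}}

  1/[1+]≡mkℚ : ∀ g → 1/[1+ g ] ≡ mkℚ (ℤ.+ 1) g (ℕᶜ.1-coprimeTo (suc g))
  1/[1+]≡mkℚ g = 1/-cong {{fromℕ-suc-nonZero g}} (fromℕ≡mkℚ (suc g))
    where
    1/-cong : ∀ {p q} .{{_ : ℚ.NonZero p}} .{{_ : ℚ.NonZero q}} → p ≡ q → 1/ p ≡ 1/ q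
    1/-cong refl = refl

archimedean : ∀ ε → 0ℚ <ℚ ε → ∃ λ g → 1/[1+ g ] ≤ℚ ε
archimedean ε@(mkℚ ℤ.+[1+ n ] g _) _ = g , subst (_≤ℚ ε) (sym (1/[1+]≡mkℚ g))
  (ℚ.*≤* (ℤ.+≤+ (ℕₚ.*-monoˡ-≤ (suc g) (s≤s (z≤n {n})))))
archimedean (mkℚ (ℤ.+ 0)    _ _) (ℚ.*<* (ℤ.+<+ ()))
archimedean (mkℚ ℤ.-[1+ _ ] _ _) (ℚ.*<* ())

instance
  1/[1+]-nonNegative : ∀ {g} → ℚ.NonNegative 1/[1+ g ]
  1/[1+]-nonNegative {g} = ℚₚ.pos⇒nonNeg 1/[1+ g ]

1/[1+]-unique : ∀ g p → p *ℚ fromℕ (suc g) ≡ 1ℚ → p ≡ 1/[1+ g ]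
1/[1+]-unique g p p*[1+g]≡1 = begin
  p                                  ≡⟨ ℚₚ.*-identityʳ p ⟨
  p *ℚ 1ℚ                            ≡⟨ cong (p *ℚ_) (1/[1+]-inverse g) ⟨
  p *ℚ (1/[1+ g ] *ℚ fromℕ (suc g))  ≡⟨ solve 3 (λ p s n → p :* (s :* n) := (p :* n) :* s) refl p 1/[1+ g ] (fromℕ (suc g)) ⟩
  (p *ℚ fromℕ (suc g)) *ℚ 1/[1+ g ]  ≡⟨ cong (_*ℚ 1/[1+ g ]) p*[1+g]≡1 ⟩
  1ℚ *ℚ 1/[1+ g ]                    ≡⟨ ℚₚ.*-identityˡ 1/[1+ g ] ⟩
  1/[1+ g ]                          ∎
  where
  open ≡-Reasoning
  open ℚ-Solver.+-*-Solver

1/[1+]-* : ∀ {x y z} → suc z ≡ suc x * suc y → 1/[1+ x ] *ℚ 1/[1+ y ] ≡ 1/[1+ z ]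
1/[1+]-* {x} {y} {z} z≡xy = 1/[1+]-unique z _ (begin
  (1/[1+ x ] *ℚ 1/[1+ y ]) *ℚ fromℕ (suc z)
    ≡⟨ cong (λ n → (1/[1+ x ] *ℚ 1/[1+ y ]) *ℚ fromℕ n) z≡xy ⟩
  (1/[1+ x ] *ℚ 1/[1+ y ]) *ℚ fromℕ (suc x * suc y)
    ≡⟨ cong ((1/[1+ x ] *ℚ 1/[1+ y ]) *ℚ_) (fromℕ-* (suc x) (suc y)) ⟩
  (1/[1+ x ] *ℚ 1/[1+ y ]) *ℚ (fromℕ (suc x) *ℚ fromℕ (suc y))
    ≡⟨ solve 4 (λ a b c d → (a :* b) :* (c :* d) := (a :* c) :* (b :* d)) refl 1/[1+ x ] 1/[1+ y ] (fromℕ (suc x)) (fromℕ (suc y)) ⟩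
  (1/[1+ x ] *ℚ fromℕ (suc x)) *ℚ (1/[1+ y ] *ℚ fromℕ (suc y))
    ≡⟨ cong₂ _*ℚ_ (1/[1+]-inverse x) (1/[1+]-inverse y) ⟩
  1ℚ *ℚ 1ℚ
    ≡⟨⟩
  1ℚ ∎)
  where
  open ≡-Reasoning
  open ℚ-Solver.+-*-Solver

1/[1+]-≤-scaled : ∀ p q c → fromℕ (suc q) ≤ℚ c *ℚ fromℕ (suc p) → 1/[1+ p ] ≤ℚ c *ℚ 1/[1+ q ]
1/[1+]-≤-scaled p q c q≤cp = begin
  1/[1+ p ]                                               ≡⟨ ℚₚ.*-identityʳ 1/[1+ p ] ⟨
  1/[1+ p ] *ℚ 1ℚ                                         ≡⟨ cong (1/[1+ p ] *ℚ_) (1/[1+]-inverse q) ⟨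
  1/[1+ p ] *ℚ (1/[1+ q ] *ℚ fromℕ (suc q))               ≤⟨ ℚₚ.*-monoˡ-≤-nonNeg 1/[1+ p ] (ℚₚ.*-monoˡ-≤-nonNeg 1/[1+ q ] q≤cp) ⟩
  1/[1+ p ] *ℚ (1/[1+ q ] *ℚ (c *ℚ fromℕ (suc p)))        ≡⟨ solve 4 (λ x y c n → x :* (y :* (c :* n)) := (c :* y) :* (x :* n)) refl 1/[1+ p ] 1/[1+ q ] c (fromℕ (suc p)) ⟩
  (c *ℚ 1/[1+ q ]) *ℚ (1/[1+ p ] *ℚ fromℕ (suc p))        ≡⟨ cong ((c *ℚ 1/[1+ q ]) *ℚ_) (1/[1+]-inverse p) ⟩
  (c *ℚ 1/[1+ q ]) *ℚ 1ℚ                                  ≡⟨ ℚₚ.*-identityʳ (c *ℚ 1/[1+ q ]) ⟩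
  c *ℚ 1/[1+ q ]                                          ∎
  where
  open ℚₚ.≤-Reasoning
  open ℚ-Solver.+-*-Solver

_∈[_,_] : ℚ → ℚ → ℚ → Set
x ∈[ l , u ] = l ≤ℚ x × x ≤ℚ u

_∈⟨_,_⟩ : ℚ → ℚ → ℚ → Set
x ∈⟨ l , u ⟩ = l <ℚ x × x <ℚ u

<⇒≱ : ∀ {a b} → a <ℚ b → ¬ (b ≤ℚ a)
<⇒≱ a<b b≤a = ℚₚ.<-irrefl refl (ℚₚ.<-≤-trans a<b b≤a)

record IsOrderIso (f g : ℚ → ℚ) : Set where
  field
    mono-≤   : ∀ {a b} → a ≤ℚ b → f a ≤ℚ f b
    cancel-≤ : ∀ {a b} → f a ≤ℚ f b → a ≤ℚ b
    f∘g      : ∀ x → f (g x) ≡ x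

  mono-< : ∀ {a b} → a <ℚ b → f a <ℚ f b
  mono-< {a} {b} a<b with f a ℚₚ.<? f b
  ... | yes fa<fb = fa<fb
  ... | no  fa≮fb = contradiction (cancel-≤ (ℚₚ.≮⇒≥ fa≮fb)) (<⇒≱ a<b)

  cancel-< : ∀ {a b} → f a <ℚ f b → a <ℚ b
  cancel-< {a} {b} fa<fb with a ℚₚ.<? b
  ... | yes a<b = a<b
  ... | no  a≮b = contradiction (mono-≤ (ℚₚ.≮⇒≥ a≮b)) (<⇒≱ fa<fb)

  ≤-inverse : ∀ {a x} → f a ≤ℚ x ⇔ a ≤ℚ g x
  ≤-inverse {a} {x} = mk⇔ (λ h → cancel-≤ (subst (f a ≤ℚ_) (sym (f∘g x)) h))
                          (λ h → subst (f a ≤ℚ_) (f∘g x) (mono-≤ h))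

  inverse-≤ : ∀ {a x} → x ≤ℚ f a ⇔ g x ≤ℚ a
  inverse-≤ {a} {x} = mk⇔ (λ h → cancel-≤ (subst (_≤ℚ f a) (sym (f∘g x)) h))
                          (λ h → subst (_≤ℚ f a) (f∘g x) (mono-≤ h))

  <-inverse : ∀ {a x} → f a <ℚ x ⇔ a <ℚ g x
  <-inverse {a} {x} = mk⇔ (λ h → cancel-< (subst (f a <ℚ_) (sym (f∘g x)) h))
                          (λ h → subst (f a <ℚ_) (f∘g x) (mono-< h))

  inverse-< : ∀ {a x} → x <ℚ f a ⇔ g x <ℚ a
  inverse-< {a} {x} = mk⇔ (λ h → cancel-< (subst (_<ℚ f a) (sym (f∘g x)) h))
                          (λ h → subst (_<ℚ f a) (f∘g x) (mono-< h))

  ∈[]-inverse : ∀ {l u x} → x ∈[ f l , f u ] ⇔ g x ∈[ l , u ]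
  ∈[]-inverse = mk⇔ (λ (l≤x , x≤u) → to ≤-inverse l≤x , to inverse-≤ x≤u)
                    (λ (l≤x , x≤u) → from ≤-inverse l≤x , from inverse-≤ x≤u)

  ∈⟨⟩-inverse : ∀ {l u x} → x ∈⟨ f l , f u ⟩ ⇔ g x ∈⟨ l , u ⟩
  ∈⟨⟩-inverse = mk⇔ (λ (l<x , x<u) → to <-inverse l<x , to inverse-< x<u)
                    (λ (l<x , x<u) → from <-inverse l<x , from inverse-< x<u)

translation-iso : ∀ o → IsOrderIso (o +ℚ_) (_-ℚ o)
translation-iso o = record
  { mono-≤   = ℚₚ.+-monoʳ-≤ o
  ; cancel-≤ = λ {a} {b} h → subst₂ _≤ℚ_ (cancel a) (cancel b) (ℚₚ.+-monoʳ-≤ (- o) h)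
  ; f∘g      = λ x → solve 2 (λ o x → o :+ (x :- o) := x) refl o x
  }
  where
  open ℚ-Solver.+-*-Solver
  cancel : ∀ a → - o +ℚ (o +ℚ a) ≡ a
  cancel a = solve 2 (λ o a → :- o :+ (o :+ a) := a) refl o a

scaling-iso : ∀ s .{{_ : ℚ.Positive s}} → IsOrderIso (s *ℚ_) ((1/ s) {{ℚₚ.pos⇒nonZero s}} *ℚ_)
scaling-iso s = record
  { mono-≤   = ℚₚ.*-monoˡ-≤-nonNeg s {{ℚₚ.pos⇒nonNeg s}}
  ; cancel-≤ = ℚₚ.*-cancelˡ-≤-pos s
  ; f∘g      = λ x → begin
      s *ℚ (1/s *ℚ x)   ≡⟨ ℚₚ.*-assoc s 1/s x ⟨
      (s *ℚ 1/s) *ℚ x   ≡⟨ cong (_*ℚ x) (ℚₚ.*-inverseʳ s {{ℚₚ.pos⇒nonZero s}}) ⟩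
      1ℚ *ℚ x           ≡⟨ ℚₚ.*-identityˡ x ⟩
      x                 ∎
  }
  where
  open ≡-Reasoning
  1/s = (1/ s) {{ℚₚ.pos⇒nonZero s}}

module _ {d : ℕ} where

  upper : Cube d → Fin d → ℚ
  upper q i = corner q i +ℚ side q

  _⊑_ : Cube d → Cube d → Set
  q ⊑ Q = ∀ i → corner Q i ≤ℚ corner q i × upper q i ≤ℚ upper Q i

  ⊑-trans : ∀ {q r Q} → q ⊑ r → r ⊑ Q → q ⊑ Q
  ⊑-trans q⊑r r⊑Q i = ℚₚ.≤-trans (proj₁ (r⊑Q i)) (proj₁ (q⊑r i)) , ℚₚ.≤-trans (proj₂ (q⊑r i)) (proj₂ (r⊑Q i))

  ∈int-⊑ : ∀ {x q Q} → x ∈int q → q ⊑ Q → x ∈int Q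
  ∈int-⊑ x∈q q⊑Q i = ℚₚ.≤-<-trans (proj₁ (q⊑Q i)) (proj₁ (x∈q i)) , ℚₚ.<-≤-trans (proj₂ (x∈q i)) (proj₂ (q⊑Q i))

  module CubeImage (f g : Fin d → ℚ → ℚ) (iso : ∀ i → IsOrderIso (f i) (g i)) (image : Cube d → Cube d)
    (corner-image : ∀ q i → corner (image q) i ≡ f i (corner q i))
    (upper-image  : ∀ q i → upper (image q) i ≡ f i (upper q i)) where

    ∈C-image : ∀ {x q} → x ∈C image q ⇔ (λ i → g i (x i)) ∈C q
    ∈C-image {x} {q} = mk⇔
      (λ h i → to (IsOrderIso.∈[]-inverse (iso i)) (subst₂ (x i ∈[_,_]) (corner-image q i) (upper-image q i) (h i)))
      (λ h i → subst₂ (x i ∈[_,_]) (sym (corner-image q i)) (sym (upper-image q i)) (from (IsOrderIso.∈[]-inverse (iso i)) (h i)))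

    ∈int-image : ∀ {x q} → x ∈int image q ⇔ (λ i → g i (x i)) ∈int q
    ∈int-image {x} {q} = mk⇔
      (λ h i → to (IsOrderIso.∈⟨⟩-inverse (iso i)) (subst₂ (x i ∈⟨_,_⟩) (corner-image q i) (upper-image q i) (h i)))
      (λ h i → subst₂ (x i ∈⟨_,_⟩) (sym (corner-image q i)) (sym (upper-image q i)) (from (IsOrderIso.∈⟨⟩-inverse (iso i)) (h i)))

    image-mono-⊑ : ∀ {q Q} → q ⊑ Q → image q ⊑ image Q
    image-mono-⊑ {q} {Q} q⊑Q i =
      subst₂ _≤ℚ_ (sym (corner-image Q i)) (sym (corner-image q i)) (IsOrderIso.mono-≤ (iso i) (proj₁ (q⊑Q i))) ,
      subst₂ _≤ℚ_ (sym (upper-image q i)) (sym (upper-image Q i)) (IsOrderIso.mono-≤ (iso i) (proj₂ (q⊑Q i)))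

  scale : (s : ℚ) .{{_ : ℚ.Positive s}} → Cube d → Cube d
  scale s q = cube (λ i → s *ℚ corner q i) (s *ℚ side q)
    (ℚₚ.positive⁻¹ (s *ℚ side q) {{ℚₚ.pos*pos⇒pos s (side q) {{ℚ.positive (side>0 q)}}}})

  translate : Point d → Cube d → Cube d
  translate o q = cube (λ i → o i +ℚ corner q i) (side q) (side>0 q)

  upper-scale : ∀ s .{{_ : ℚ.Positive s}} q i → upper (scale s q) i ≡ s *ℚ upper q i
  upper-scale s q i = sym (ℚₚ.*-distribˡ-+ s (corner q i) (side q))

  module Scale (s : ℚ) .{{_ : ℚ.Positive s}} = CubeImage (λ _ → s *ℚ_) (λ _ → (1/ s) {{ℚₚ.pos⇒nonZero s}} *ℚ_)
    (λ _ → scaling-iso s) (scale s) (λ _ _ → refl) (upper-scale s)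

  module Translate (o : Point d) = CubeImage (λ i → o i +ℚ_) (λ i → _-ℚ o i)
    (λ i → translation-iso (o i)) (translate o) (λ _ _ → refl)
    (λ q i → ℚₚ.+-assoc (o i) (corner q i) (side q))

fromℕ-+1 : ∀ n → fromℕ n +ℚ 1ℚ ≡ fromℕ (suc n)
fromℕ-+1 n = trans (ℚₚ.+-comm (fromℕ n) 1ℚ) (sym (fromℕ-suc n))

∈[]-unitInterval : ∀ n {z} → z ∈[ fromℕ n , fromℕ (suc n) ] ⇔ (z -ℚ fromℕ n) ∈[ 0ℚ , 1ℚ ]
∈[]-unitInterval n {z} = mk⇔
  (λ h → to (IsOrderIso.∈[]-inverse (translation-iso (fromℕ n))) (subst₂ (z ∈[_,_]) (sym (ℚₚ.+-identityʳ (fromℕ n))) (sym (fromℕ-+1 n)) h))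
  (λ h → subst₂ (z ∈[_,_]) (ℚₚ.+-identityʳ (fromℕ n)) (fromℕ-+1 n) (from (IsOrderIso.∈[]-inverse (translation-iso (fromℕ n))) h))

∈⟨⟩-unitInterval : ∀ n {z} → z ∈⟨ fromℕ n , fromℕ (suc n) ⟩ ⇔ (z -ℚ fromℕ n) ∈⟨ 0ℚ , 1ℚ ⟩
∈⟨⟩-unitInterval n {z} = mk⇔
  (λ h → to (IsOrderIso.∈⟨⟩-inverse (translation-iso (fromℕ n))) (subst₂ (z ∈⟨_,_⟩) (sym (ℚₚ.+-identityʳ (fromℕ n))) (sym (fromℕ-+1 n)) h))
  (λ h → subst₂ (z ∈⟨_,_⟩) (ℚₚ.+-identityʳ (fromℕ n)) (fromℕ-+1 n) (from (IsOrderIso.∈⟨⟩-inverse (translation-iso (fromℕ n))) h))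

fromℕ-bracket : ∀ g {z} → 0ℚ ≤ℚ z → z ≤ℚ fromℕ (suc g) →
  ∃ λ (k : Fin (suc g)) → z ∈[ fromℕ (toℕ k) , fromℕ (suc (toℕ k)) ]
fromℕ-bracket zero {z} 0≤z z≤1 = Fin.zero , subst (_≤ℚ z) (sym fromℕ-zero) 0≤z , z≤1
fromℕ-bracket (suc g) {z} 0≤z z≤g+2 with z ℚₚ.≤? fromℕ (suc g)
... | yes z≤g+1 = let k , z∈k = fromℕ-bracket g 0≤z z≤g+1 in
  Fin.inject₁ k , subst (λ n → z ∈[ fromℕ n , fromℕ (suc n) ]) (sym (Finₚ.toℕ-inject₁ k)) z∈k
... | no  z≰g+1 = Fin.fromℕ (suc g) ,
  subst (λ n → z ∈[ fromℕ n , fromℕ (suc n) ]) (sym (Finₚ.toℕ-fromℕ (suc g))) (ℚₚ.<⇒≤ (ℚₚ.≰⇒> z≰g+1) , z≤g+2)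

fromℕ-bracket-unique : ∀ {m n z} → z ∈⟨ fromℕ m , fromℕ (suc m) ⟩ → z ∈⟨ fromℕ n , fromℕ (suc n) ⟩ → m ≡ n
fromℕ-bracket-unique (m<z , z<m+1) (n<z , z<n+1) = ℕₚ.≤-antisym
  (ℕₚ.≤-pred (fromℕ-cancel-< (ℚₚ.<-trans m<z z<n+1)))
  (ℕₚ.≤-pred (fromℕ-cancel-< (ℚₚ.<-trans n<z z<m+1)))

module _ {d : ℕ} where

  unitCube : Cube d
  unitCube = cube (λ _ → 0ℚ) 1ℚ (ℚₚ.positive⁻¹ 1ℚ)

  offset : ∀ {G} → Vec (Fin G) d → Point d
  offset c i = fromℕ (toℕ (lookup c i))

  place : (g : ℕ) → Vec (Fin (suc g)) d → Cube d → Cube d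
  place g c q = scale 1/[1+ g ] (translate (offset c) q)

  cell : (g : ℕ) → Vec (Fin (suc g)) d → Cube d
  cell g c = place g c unitCube

  cellCoords : ℕ → Point d → Point d
  cellCoords g x i = (1/ 1/[1+ g ]) {{ℚₚ.pos⇒nonZero 1/[1+ g ]}} *ℚ x i

  module _ (g : ℕ) (c : Vec (Fin (suc g)) d) where

    ∈C-place : ∀ {q x} → x ∈C place g c q ⇔ (λ i → cellCoords g x i -ℚ offset c i) ∈C q
    ∈C-place {q} {x} = mk⇔
      (λ h → to (Translate.∈C-image (offset c) {q = q}) (to (Scale.∈C-image 1/[1+ g ] {x} {translate (offset c) q}) h))
      (λ h → from (Scale.∈C-image 1/[1+ g ] {x} {translate (offset c) q}) (from (Translate.∈C-image (offset c) {q = q}) h))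

    ∈int-place : ∀ {q x} → x ∈int place g c q ⇔ (λ i → cellCoords g x i -ℚ offset c i) ∈int q
    ∈int-place {q} {x} = mk⇔
      (λ h → to (Translate.∈int-image (offset c) {q = q}) (to (Scale.∈int-image 1/[1+ g ] {x} {translate (offset c) q}) h))
      (λ h → from (Scale.∈int-image 1/[1+ g ] {x} {translate (offset c) q}) (from (Translate.∈int-image (offset c) {q = q}) h))

    place-mono-⊑ : ∀ {q Q} → q ⊑ Q → place g c q ⊑ place g c Q
    place-mono-⊑ {q} {Q} q⊑Q = Scale.image-mono-⊑ 1/[1+ g ] {translate (offset c) q} {translate (offset c) Q} (Translate.image-mono-⊑ (offset c) {q} {Q} q⊑Q)

    cell-⊑-unitCube : cell g c ⊑ unitCube
    cell-⊑-unitCube i =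
      ℚₚ.nonNegative⁻¹ _ {{ℚₚ.nonNeg*nonNeg⇒nonNeg 1/[1+ g ] (offset c i +ℚ 0ℚ) {{ℚ.nonNegative 0≤c}}}} ,
      (begin
        upper (cell g c) i                       ≡⟨ upper-scale 1/[1+ g ] (translate (offset c) unitCube) i ⟩
        1/[1+ g ] *ℚ ((offset c i +ℚ 0ℚ) +ℚ 1ℚ)  ≡⟨ cong (λ y → 1/[1+ g ] *ℚ (y +ℚ 1ℚ)) (ℚₚ.+-identityʳ (offset c i)) ⟩
        1/[1+ g ] *ℚ (offset c i +ℚ 1ℚ)          ≡⟨ cong (1/[1+ g ] *ℚ_) (fromℕ-+1 (toℕ (lookup c i))) ⟩
        1/[1+ g ] *ℚ fromℕ (suc (toℕ (lookup c i)))  ≤⟨ ℚₚ.*-monoˡ-≤-nonNeg 1/[1+ g ] (fromℕ-mono-≤ (Finₚ.toℕ<n (lookup c i))) ⟩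
        1/[1+ g ] *ℚ fromℕ (suc g)               ≡⟨ 1/[1+]-inverse g ⟩
        1ℚ                                       ∎)
      where
      open ℚₚ.≤-Reasoning
      0≤c : 0ℚ ≤ℚ offset c i +ℚ 0ℚ
      0≤c = subst (0ℚ ≤ℚ_) (sym (ℚₚ.+-identityʳ (offset c i))) (fromℕ-nonNeg _)

  cell-unique : ∀ {g x} {c c′ : Vec (Fin (suc g)) d} → x ∈int cell g c → x ∈int cell g c′ → c ≡ c′
  cell-unique {g} {x} {c} {c′} x∈c x∈c′ = begin
    c                      ≡⟨ Vecₚ.tabulate∘lookup c ⟨
    tabulate (lookup c)    ≡⟨ Vecₚ.tabulate-cong (λ i → Finₚ.toℕ-injective (fromℕ-bracket-unique (bracket c x∈c i) (bracket c′ x∈c′ i))) ⟩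
    tabulate (lookup c′)   ≡⟨ Vecₚ.tabulate∘lookup c′ ⟩
    c′                     ∎
    where
    open ≡-Reasoning
    bracket : ∀ b → x ∈int cell g b → ∀ i → cellCoords g x i ∈⟨ fromℕ (toℕ (lookup b i)) , fromℕ (suc (toℕ (lookup b i))) ⟩
    bracket b x∈b i = from (∈⟨⟩-unitInterval (toℕ (lookup b i))) (to (∈int-place g b {unitCube}) x∈b i)

  cell-of : ∀ g {x} → InUnitCube x → ∃ λ (c : Vec (Fin (suc g)) d) → x ∈C cell g c
  cell-of g {x} x∈unit = c , from (∈C-place g c {unitCube}) (λ i → subst (λ k → (cellCoords g x i -ℚ fromℕ (toℕ k)) ∈[ 0ℚ , 1ℚ ])
      (sym (Vecₚ.lookup∘tabulate k i)) (to (∈[]-unitInterval (toℕ (k i))) (proj₂ (bracket i))))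
    where
    z∈[0,g+1] : ∀ i → cellCoords g x i ∈[ 0ℚ , fromℕ (suc g) ]
    z∈[0,g+1] i = to (IsOrderIso.∈[]-inverse (scaling-iso 1/[1+ g ]))
      (subst₂ (x i ∈[_,_]) (sym (ℚₚ.*-zeroʳ 1/[1+ g ])) (sym (1/[1+]-inverse g)) (x∈unit i))
    bracket : ∀ i → ∃ λ (k : Fin (suc g)) → cellCoords g x i ∈[ fromℕ (toℕ k) , fromℕ (suc (toℕ k)) ]
    bracket i = fromℕ-bracket g (proj₁ (z∈[0,g+1] i)) (proj₂ (z∈[0,g+1] i))
    k : Fin d → Fin (suc g)
    k i = proj₁ (bracket i)
    c : Vec (Fin (suc g)) d
    c = tabulate k

module _ {A B : Set} where

  length-cartesianProductWith : ∀ {C : Set} (f : A → B → C) xs ys →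
    length (cartesianProductWith f xs ys) ≡ length xs * length ys
  length-cartesianProductWith f []       ys = refl
  length-cartesianProductWith f (x ∷ xs) ys = begin
    length (map (f x) ys ++ cartesianProductWith f xs ys)          ≡⟨ Listₚ.length-++ (map (f x) ys) ⟩
    length (map (f x) ys) + length (cartesianProductWith f xs ys)  ≡⟨ cong₂ _+_ (Listₚ.length-map (f x) ys) (length-cartesianProductWith f xs ys) ⟩
    length ys + length xs * length ys                              ∎
    where open ≡-Reasoning

  zip-All⁺ʳ : ∀ {P : B → Set} (xs : List A) {ys} → All P ys → All (P ∘ proj₂) (zip xs ys)
  zip-All⁺ʳ []       _          = []
  zip-All⁺ʳ (x ∷ xs) []         = []
  zip-All⁺ʳ (x ∷ xs) (py ∷ pys) = py ∷ zip-All⁺ʳ xs pys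

  zip-All⁺ˡ : ∀ {P : A → Set} {xs} (ys : List B) → All P xs → All (P ∘ proj₁) (zip xs ys)
  zip-All⁺ˡ ys       []         = []
  zip-All⁺ˡ []       (_ ∷ _)    = []
  zip-All⁺ˡ (y ∷ ys) (px ∷ pxs) = px ∷ zip-All⁺ˡ ys pxs

  zip-AllPairs⁺ˡ : ∀ {R : A → A → Set} {xs} (ys : List B) → AllPairs R xs → AllPairs (R on proj₁) (zip xs ys)
  zip-AllPairs⁺ˡ ys       []         = []
  zip-AllPairs⁺ˡ []       (_ ∷ _)    = []
  zip-AllPairs⁺ˡ (y ∷ ys) (rx ∷ rxs) = zip-All⁺ˡ ys rx ∷ zip-AllPairs⁺ˡ ys rxs

  ∈-zip⁺ˡ : ∀ {x : A} {xs} {ys : List B} → length xs ≡ length ys → x ∈ xs → ∃ λ y → (x , y) ∈ zip xs ys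
  ∈-zip⁺ˡ {xs = _ ∷ _} {y ∷ _}  _  (here refl) = y , here refl
  ∈-zip⁺ˡ {xs = _ ∷ _} {_ ∷ ys} eq (there x∈xs) = let y , xy∈ = ∈-zip⁺ˡ (ℕₚ.suc-injective eq) x∈xs in y , there xy∈

AllPairs-lookup : ∀ {A : Set} {R : A → A → Set} → Symmetric R → ∀ {xs} → AllPairs R xs →
  ∀ {i j} → i ≢ j → R (List.lookup xs i) (List.lookup xs j)
AllPairs-lookup R-sym {_ ∷ _} (rx ∷ rxs) {Fin.zero}  {Fin.zero}  i≢j = contradiction refl i≢j
AllPairs-lookup R-sym {_ ∷ _} (rx ∷ rxs) {Fin.zero}  {Fin.suc j} i≢j = All.lookup rx (∈ₚ.∈-lookup j)
AllPairs-lookup R-sym {_ ∷ _} (rx ∷ rxs) {Fin.suc i} {Fin.zero}  i≢j = R-sym (All.lookup rx (∈ₚ.∈-lookup i))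
AllPairs-lookup R-sym {_ ∷ _} (rx ∷ rxs) {Fin.suc i} {Fin.suc j} i≢j = AllPairs-lookup R-sym rxs (i≢j ∘ cong Fin.suc)

AllPairs-mapWithAll : ∀ {A : Set} {P : A → Set} {R S : A → A → Set} →
  (∀ {x y} → P x → P y → R x y → S x y) → ∀ {xs} → All P xs → AllPairs R xs → AllPairs S xs
AllPairs-mapWithAll f []         []         = []
AllPairs-mapWithAll f (px ∷ pxs) (rx ∷ rxs) =
  All.zipWith (λ (py , rxy) → f px py rxy) (pxs , rx) ∷ AllPairs-mapWithAll f pxs rxs

allVecs : (G n : ℕ) → List (Vec (Fin G) n)
allVecs G zero    = [] ∷ []
allVecs G (suc n) = cartesianProductWith _∷_ (allFin G) (allVecs G n)

∈-allVecs : ∀ {G n} (v : Vec (Fin G) n) → v ∈ allVecs G n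
∈-allVecs []      = here refl
∈-allVecs (i ∷ v) = Anyₚ.cartesianProductWith⁺ _∷_ (cong₂ _∷_) (∈ₚ.∈-allFin i) (∈-allVecs v)

allVecs-unique : ∀ G n → Unique (allVecs G n)
allVecs-unique G zero    = [] ∷ []
allVecs-unique G (suc n) = Uniqueₚ.cartesianProductWith⁺ _∷_ Vecₚ.∷-injective (Uniqueₚ.allFin⁺ G) (allVecs-unique G n)

length-allVecs : ∀ G n → length (allVecs G n) ≡ G ^ n
length-allVecs G zero    = refl
length-allVecs G (suc n) = begin
  length (cartesianProductWith _∷_ (allFin G) (allVecs G n))  ≡⟨ length-cartesianProductWith _∷_ (allFin G) (allVecs G n) ⟩
  length (allFin G) * length (allVecs G n)                    ≡⟨ cong₂ _*_ (Listₚ.length-tabulate {n = G} id) (length-allVecs G n) ⟩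
  G * G ^ n                                                   ∎
  where open ≡-Reasoning

module _ {d : ℕ} where

  InteriorsDisjoint : Cube d → Cube d → Set
  InteriorsDisjoint q r = ¬ (∃ λ x → (x ∈int q) × (x ∈int r))

  InteriorsDisjoint-sym : Symmetric InteriorsDisjoint
  InteriorsDisjoint-sym q∩r (x , x∈r , x∈q) = q∩r (x , x∈q , x∈r)

  record IsTiling (P : List (Cube d)) : Set where
    field
      inside   : All (_⊑ unitCube) P
      covers   : ∀ x → InUnitCube x → Any (x ∈C_) P
      disjoint : AllPairs InteriorsDisjoint P
  open IsTiling

  unitCube-isTiling : IsTiling (unitCube ∷ [])
  unitCube-isTiling = record
    { inside   = (λ i → ℚₚ.≤-refl , ℚₚ.≤-refl) ∷ []
    ; covers   = λ x x∈unit → here x∈unit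
    ; disjoint = [] ∷ []
    }

  isTiling⇒isDecomposition : ∀ {P} → IsTiling P → IsDecomposition (List.lookup P)
  isTiling⇒isDecomposition T =
    (λ j → All.lookup (inside T) (∈ₚ.∈-lookup j)) ,
    (λ x x∈unit → let x∈P = covers T x x∈unit in Any.index x∈P , Anyₚ.lookup-index x∈P) ,
    (λ j k j≢k → AllPairs-lookup (λ {q} {r} → InteriorsDisjoint-sym {q} {r}) (disjoint T) j≢k)

  block : (g : ℕ) → Vec (Fin (suc g)) d × List (Cube d) → List (Cube d)
  block g (c , P) = map (place g c) P

  -- g + 1 cells per side; the patterns Ps fill the cells in the order of allVecs.
  grid : ℕ → List (List (Cube d)) → List (Cube d)
  grid g Ps = concatMap (block g) (zip (allVecs (suc g) d) Ps)

  block-⊑-cell : ∀ g c {P} → All (_⊑ unitCube) P → All (_⊑ cell g c) (block g (c , P))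
  block-⊑-cell g c P⊑unit = Allₚ.map⁺ (All.map (λ {q} → place-mono-⊑ g c {q} {unitCube}) P⊑unit)

  grid-isTiling : ∀ g Ps → length Ps ≡ suc g ^ d → All IsTiling Ps → IsTiling (grid g Ps)
  grid-isTiling g Ps len tilings = record
    { inside   = Allₚ.concat⁺ (Allₚ.map⁺ (All.map (λ {b} → blockInside {b}) blockTilings))
    ; covers   = cover
    ; disjoint = AllPairsₚ.concat⁺ (Allₚ.map⁺ (All.map (λ {b} → blockDisjoint {b}) blockTilings))
                   (AllPairsₚ.map⁺ (AllPairs-mapWithAll {P = IsTiling ∘ proj₂} {R = _≢_ on proj₁}
                     (λ {b} {b′} → acrossBlocks {b} {b′}) blockTilings (zip-AllPairs⁺ˡ Ps (allVecs-unique (suc g) d))))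
    }
    where
    cs = allVecs (suc g) d
    blockTilings : All (IsTiling ∘ proj₂) (zip cs Ps)
    blockTilings = zip-All⁺ʳ cs tilings

    blockInside : ∀ {b} → IsTiling (proj₂ b) → All (_⊑ unitCube) (block g b)
    blockInside {c , P} T = All.map (λ {q} q⊑cell → ⊑-trans {q = q} {cell g c} {unitCube} q⊑cell (cell-⊑-unitCube g c))
                                    (block-⊑-cell g c (inside T))

    blockDisjoint : ∀ {b} → IsTiling (proj₂ b) → AllPairs InteriorsDisjoint (block g b)
    blockDisjoint {c , P} T = AllPairsₚ.map⁺ (AllPairs.map
      (λ {q} {r} q∩r (x , x∈q , x∈r) → q∩r (_ , to (∈int-place g c {q}) x∈q , to (∈int-place g c {r}) x∈r)) (disjoint T))

    acrossBlocks : ∀ {b b′} → IsTiling (proj₂ b) → IsTiling (proj₂ b′) → proj₁ b ≢ proj₁ b′ →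
      All (λ q → All (InteriorsDisjoint q) (block g b′)) (block g b)
    acrossBlocks {c , P} {c′ , P′} T T′ c≢c′ = All.map
      (λ {q} q⊑c → All.map (λ {r} r⊑c′ (x , x∈q , x∈r) →
                             c≢c′ (cell-unique (∈int-⊑ {q = q} {cell g c} x∈q q⊑c) (∈int-⊑ {q = r} {cell g c′} x∈r r⊑c′)))
                           (block-⊑-cell g c′ (inside T′)))
      (block-⊑-cell g c (inside T))

    cover : ∀ x → InUnitCube x → Any (x ∈C_) (grid g Ps)
    cover x x∈unit =
      let c , x∈cell = cell-of g x∈unit
          P , cP∈blocks = ∈-zip⁺ˡ (trans (length-allVecs (suc g) d) (sym len)) (∈-allVecs c)
          T = All.lookup blockTilings cP∈blocks
          y∈q = covers T _ (to (∈C-place g c {unitCube}) x∈cell)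
      in Anyₚ.concatMap⁺ (block g) (lose cP∈blocks (Anyₚ.map⁺ (Any.map (λ {q} → from (∈C-place g c {q})) y∈q)))

  length-grid : ∀ g Ps → length Ps ≡ suc g ^ d → length (grid g Ps) ≡ sum (map length Ps)
  length-grid g Ps len = length-blocks (allVecs (suc g) d) Ps (trans (length-allVecs (suc g) d) (sym len))
    where
    length-blocks : ∀ cs Ps → length cs ≡ length Ps → length (concatMap (block g) (zip cs Ps)) ≡ sum (map length Ps)
    length-blocks []       []       _  = refl
    length-blocks (c ∷ cs) (P ∷ Ps) eq = begin
      length (map (place g c) P ++ concatMap (block g) (zip cs Ps))          ≡⟨ Listₚ.length-++ (map (place g c) P) ⟩
      length (map (place g c) P) + length (concatMap (block g) (zip cs Ps))  ≡⟨ cong₂ _+_ (Listₚ.length-map (place g c) P) (length-blocks cs Ps (ℕₚ.suc-injective eq)) ⟩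
      length P + sum (map length Ps)                                         ∎
      where open ≡-Reasoning

  SidesIn : List ℚ → List (Cube d) → Set
  SidesIn σs P = All (λ q → side q ∈ σs) P

  grid-sidesIn : ∀ g {σs} Ps → All (SidesIn σs) Ps → SidesIn (map (1/[1+ g ] *ℚ_) σs) (grid g Ps)
  grid-sidesIn g Ps sides = Allₚ.concat⁺ (Allₚ.map⁺ (All.map
    (λ {(c , P)} P-sides → Allₚ.map⁺ (All.map (∈ₚ.∈-map⁺ (1/[1+ g ] *ℚ_)) P-sides))
    (zip-All⁺ʳ (allVecs (suc g) d) sides)))

^-distribʳ-* : ∀ x y e → (x * y) ^ e ≡ x ^ e * y ^ e
^-distribʳ-* x y zero    = refl
^-distribʳ-* x y (suc e) = begin
  (x * y) * (x * y) ^ e        ≡⟨ cong ((x * y) *_) (^-distribʳ-* x y e) ⟩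
  (x * y) * (x ^ e * y ^ e)    ≡⟨ solve 4 (λ x y p q → (x :* y) :* (p :* q) := (x :* p) :* (y :* q)) refl x y (x ^ e) (y ^ e) ⟩
  (x * x ^ e) * (y * y ^ e)    ∎
  where
  open ≡-Reasoning
  open ℕ-Solver.+-*-Solver

[1+m]^n≡1+m*w : ∀ m n → ∃ λ w → suc m ^ n ≡ suc (m * w)
[1+m]^n≡1+m*w m zero    = 0 , cong suc (sym (ℕₚ.*-zeroʳ m))
[1+m]^n≡1+m*w m (suc n) = let w , eq = [1+m]^n≡1+m*w m n in
  w + suc (m * w) , (begin
    suc m * suc m ^ n            ≡⟨ cong (suc m *_) eq ⟩
    suc m * suc (m * w)          ≡⟨ solve 2 (λ m w → (con 1 :+ m) :* (con 1 :+ m :* w) := con 1 :+ m :* (w :+ (con 1 :+ m :* w))) refl m w ⟩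
    suc (m * (w + suc (m * w)))  ∎)
  where
  open ≡-Reasoning
  open ℕ-Solver.+-*-Solver

p+c≤q⇒p^[1+e]+c≤q^[1+e] : ∀ {p q} .{{_ : NonZero q}} c e → p + c ≤ q → p ^ suc e + c ≤ q ^ suc e
p+c≤q⇒p^[1+e]+c≤q^[1+e] {p} {q} c e p+c≤q = begin
  p * p ^ e + c            ≤⟨ ℕₚ.+-monoʳ-≤ (p * p ^ e) (ℕₚ.m≤m*n c (q ^ e) {{ℕₚ.m^n≢0 q e}}) ⟩
  p * p ^ e + c * q ^ e    ≤⟨ ℕₚ.+-monoˡ-≤ (c * q ^ e) (ℕₚ.*-monoʳ-≤ p (ℕₚ.^-monoˡ-≤ e p≤q)) ⟩
  p * q ^ e + c * q ^ e    ≡⟨ ℕₚ.*-distribʳ-+ (q ^ e) p c ⟨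
  (p + c) * q ^ e          ≤⟨ ℕₚ.*-monoˡ-≤ (q ^ e) p+c≤q ⟩
  q * q ^ e                ∎
  where
  open ℕₚ.≤-Reasoning
  p≤q : p ≤ q
  p≤q = ℕₚ.≤-trans (ℕₚ.m≤m+n p c) p+c≤q

last-satisfying : ∀ {P : ℕ → Set} → Decidable P → ∀ {k} r → P k → ¬ P (k + r) →
  ∃ λ j → k ≤ j × P j × ¬ P (suc j)
last-satisfying {P} P? {k} zero    Pk ¬Pk+0 = contradiction (subst P (sym (ℕₚ.+-identityʳ k)) Pk) ¬Pk+0
last-satisfying {P} P? {k} (suc r) Pk ¬Pk+r with P? (suc k)
... | no  ¬Pk+1 = k , ℕₚ.≤-refl , Pk , ¬Pk+1
... | yes Pk+1  = let j , k<j , Pj , ¬Pj+1 = last-satisfying P? r Pk+1 (subst (¬_ ∘ P) (ℕₚ.+-suc k r) ¬Pk+r)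
                  in j , ℕₚ.<⇒≤ k<j , Pj , ¬Pj+1

mod-decomposition : ∀ m .{{_ : NonZero m}} {v t} → v % m ≡ 1 % m → m * v ≤ t →
  ∃ λ β → ∃ λ α → β < m × α * m + β * v ≡ t
mod-decomposition m {v} {t} v≡1[m] mv≤t = β , q ∸ r , m%n<n t m , (begin
  (q ∸ r) * m + β * v                ≡⟨ cong₂ _+_ (ℕₚ.*-distribʳ-∸ m q r) βv≡β+rm ⟩
  (q * m ∸ r * m) + (β + r * m)      ≡⟨ solve 3 (λ x b y → x :+ (b :+ y) := b :+ (x :+ y)) refl (q * m ∸ r * m) β (r * m) ⟩
  β + ((q * m ∸ r * m) + r * m)      ≡⟨ cong (β +_) (ℕₚ.m∸n+n≡m rm≤qm) ⟩
  β + q * m                          ≡⟨ t≡β+qm ⟨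
  t                                  ∎)
  where
  open ≡-Reasoning
  open ℕ-Solver.+-*-Solver
  β = t % m
  q = t / m
  r = (β * v) / m
  t≡β+qm : t ≡ β + q * m
  t≡β+qm = m≡m%n+[m/n]*n t m
  βv%m≡β : (β * v) % m ≡ β
  βv%m≡β = begin
    (β * v) % m                  ≡⟨ %-distribˡ-* β v m ⟩
    ((β % m) * (v % m)) % m      ≡⟨ cong (λ z → ((β % m) * z) % m) v≡1[m] ⟩
    ((β % m) * (1 % m)) % m      ≡⟨ %-distribˡ-* β 1 m ⟨
    (β * 1) % m                  ≡⟨ cong (_% m) (ℕₚ.*-identityʳ β) ⟩
    β % m                        ≡⟨ m%n%n≡m%n t m ⟩
    β                            ∎
  βv≡β+rm : β * v ≡ β + r * m
  βv≡β+rm = trans (m≡m%n+[m/n]*n (β * v) m) (cong (_+ r * m) βv%m≡β)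
  rm≤qm : r * m ≤ q * m
  rm≤qm = ℕₚ.+-cancelˡ-≤ β (r * m) (q * m) (subst₂ _≤_ βv≡β+rm t≡β+qm
    (ℕₚ.≤-trans (ℕₚ.*-monoˡ-≤ v (ℕₚ.<⇒≤ (m%n<n t m))) mv≤t))

split-bound : ∀ α β K M → α + β * M < K * M → β ≤ K × α ≤ (K ∸ β) * M
split-bound α β K M α+βM<KM = ℕₚ.<⇒≤ β<K , ℕₚ.<⇒≤ α<[K∸β]M
  where
  β<K : β < K
  β<K = ℕₚ.*-cancelʳ-< M β K (ℕₚ.≤-<-trans (ℕₚ.m≤n+m (β * M) α) α+βM<KM)
  KM≡ : K * M ≡ (K ∸ β) * M + β * M
  KM≡ = trans (cong (_* M) (sym (ℕₚ.m∸n+n≡m (ℕₚ.<⇒≤ β<K)))) (ℕₚ.*-distribʳ-+ M (K ∸ β) β)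
  α<[K∸β]M : α < (K ∸ β) * M
  α<[K∸β]M = ℕₚ.+-cancelʳ-≤ (β * M) (suc α) ((K ∸ β) * M) (subst (suc (α + β * M) ≤_) KM≡ α+βM<KM)

module Counting (d₁ a₀ : ℕ) where

  d a : ℕ
  d = suc d₁
  a = suc a₀

  m₀ m : ℕ
  m₀ = pred (suc a ^ d ∸ a ^ d)
  m  = suc m₀

  [1+a]^d≡a^d+m : suc a ^ d ≡ a ^ d + m
  [1+a]^d≡a^d+m = begin
    suc a ^ d                        ≡⟨ ℕₚ.m+[n∸m]≡n (ℕₚ.^-monoˡ-≤ d (ℕₚ.n≤1+n a)) ⟨
    a ^ d + (suc a ^ d ∸ a ^ d)      ≡⟨ cong (a ^ d +_) (ℕₚ.suc-pred _ {{>-nonZero (ℕₚ.m<n⇒0<n∸m (ℕₚ.^-monoˡ-< d (ℕₚ.n<1+n a)))}}) ⟨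
    a ^ d + m                        ∎
    where open ≡-Reasoning

  M A v : ℕ
  M = m ^ d
  A = M * a ^ d
  v = suc (m * a) ^ d ∸ (m * a) ^ d

  [1+ma]^d≡A+v : suc (m * a) ^ d ≡ A + v
  [1+ma]^d≡A+v = begin
    suc (m * a) ^ d                        ≡⟨ ℕₚ.m+[n∸m]≡n (ℕₚ.^-monoˡ-≤ d (ℕₚ.n≤1+n (m * a))) ⟨
    (m * a) ^ d + v                        ≡⟨ cong (_+ v) (^-distribʳ-* m a d) ⟩
    A + v                                  ∎
    where open ≡-Reasoning

  -- (1 + m a)^d ≡ 1 and (m a)^d ≡ 0 modulo m.
  v%m≡1%m : v % m ≡ 1 % m
  v%m≡1%m = let w , [1+ma]^d≡1+maw = [1+m]^n≡1+m*w (m * a) d in begin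
    v % m                             ≡⟨ [m+kn]%n≡m%n v (a * (m * a) ^ d₁) m ⟨
    (v + (a * (m * a) ^ d₁) * m) % m  ≡⟨ cong (_% m) (begin
        v + (a * (m * a) ^ d₁) * m    ≡⟨ solve 4 (λ v a p m → v :+ (a :* p) :* m := (m :* a) :* p :+ v) refl v a ((m * a) ^ d₁) m ⟩
        (m * a) ^ d + v               ≡⟨ ℕₚ.m+[n∸m]≡n (ℕₚ.^-monoˡ-≤ d (ℕₚ.n≤1+n (m * a))) ⟩
        suc (m * a) ^ d               ≡⟨ [1+ma]^d≡1+maw ⟩
        suc (m * a * w)               ≡⟨ solve 3 (λ m a w → con 1 :+ m :* a :* w := con 1 :+ (a :* w) :* m) refl m a w ⟩
        1 + (a * w) * m               ∎) ⟩
    (1 + (a * w) * m) % m             ≡⟨ [m+kn]%n≡m%n 1 (a * w) m ⟩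
    1 % m                             ∎
    where
    open ≡-Reasoning
    open ℕ-Solver.+-*-Solver

  f : ℕ → ℕ
  f k = k ^ d * A + m * v

  -- The constant term of f, plus room for the fewer than m fine cells of a representation.
  C : ℕ
  C = m * v + m * (m * M)

  n₀ : ℕ
  n₀ = f (a + C)

  growth : ∀ k → a + C ≤ k → suc k ^ d * A + C ≤ k ^ d * (M * suc a ^ d)
  growth k@(suc _) a+C≤k = subst₂ (λ x y → x + C ≤ y) P^d≡ Q^d≡ (p+c≤q⇒p^[1+e]+c≤q^[1+e] {{Q≢0}} C d₁ P+C≤Q)
    where
    open ℕₚ.≤-Reasoning
    open ℕ-Solver.+-*-Solver
    P Q : ℕ
    P = suc k * (m * a)
    Q = k * (m * suc a)
    Q≢0 : NonZero Q
    Q≢0 = ℕₚ.m*n≢0 k (m * suc a) {{_}} {{ℕₚ.m*n≢0 m (suc a)}}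
    P^d≡ : P ^ d ≡ suc k ^ d * A
    P^d≡ = trans (^-distribʳ-* (suc k) (m * a) d) (cong (suc k ^ d *_) (^-distribʳ-* m a d))
    Q^d≡ : Q ^ d ≡ k ^ d * (M * suc a ^ d)
    Q^d≡ = trans (^-distribʳ-* k (m * suc a) d) (cong (k ^ d *_) (^-distribʳ-* m (suc a) d))
    P+C≤Q : P + C ≤ Q
    P+C≤Q = begin
      P + C                      ≡⟨ solve 4 (λ k m a c → (con 1 :+ k) :* (m :* a) :+ c := k :* (m :* a) :+ (m :* a :+ c)) refl k m a C ⟩
      k * (m * a) + (m * a + C)  ≤⟨ ℕₚ.+-monoʳ-≤ (k * (m * a)) (ℕₚ.+-monoʳ-≤ (m * a) (ℕₚ.m≤m*n C m)) ⟩
      k * (m * a) + (m * a + C * m) ≡⟨ cong (k * (m * a) +_) (solve 3 (λ m a c → m :* a :+ c :* m := (a :+ c) :* m) refl m a C) ⟩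
      k * (m * a) + (a + C) * m  ≤⟨ ℕₚ.+-monoʳ-≤ (k * (m * a)) (ℕₚ.*-monoˡ-≤ m a+C≤k) ⟩
      k * (m * a) + k * m        ≡⟨ solve 3 (λ k m a → k :* (m :* a) :+ k :* m := k :* (m :* (con 1 :+ a))) refl k m a ⟩
      Q                          ∎

  Representation : ℕ → ℕ → Set
  Representation k n = ∃ λ β → ∃ λ γ → ∃ λ α →
    β + γ ≡ k ^ d × α ≤ γ * M × β * (A + v) + (γ * A + α * m) ≡ n

  -- Write n - k^d A = α m + β v with β < m; since n < f (1 + k), growth leaves room for α + β M < k^d M.
  representation-in-bracket : ∀ {k n} → a + C ≤ k → f k ≤ n → n < f (suc k) → Representation k n
  representation-in-bracket {k} {n} a+C≤k fk≤n n<f[1+k] =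
    β , K ∸ β , α , ℕₚ.m+[n∸m]≡n β≤K , α≤[K∸β]M , count
    where
    open ℕ-Solver.+-*-Solver
    K t : ℕ
    K = k ^ d
    t = n ∸ K * A
    KA+t≡n : K * A + t ≡ n
    KA+t≡n = ℕₚ.m+[n∸m]≡n (ℕₚ.≤-trans (ℕₚ.m≤m+n (K * A) (m * v)) fk≤n)
    mv≤t : m * v ≤ t
    mv≤t = ℕₚ.+-cancelˡ-≤ (K * A) (m * v) t (subst (K * A + m * v ≤_) (sym KA+t≡n) fk≤n)
    decomposition = mod-decomposition m v%m≡1%m mv≤t
    β α : ℕ
    β = proj₁ decomposition
    α = proj₁ (proj₂ decomposition)
    β<m : β < m
    β<m = proj₁ (proj₂ (proj₂ decomposition))
    αm+βv≡t : α * m + β * v ≡ t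
    αm+βv≡t = proj₂ (proj₂ (proj₂ decomposition))
    t+mmM<KMm : K * A + (t + m * (m * M)) < K * A + K * M * m
    t+mmM<KMm = begin-strict
      K * A + (t + m * (m * M))    ≡⟨ ℕₚ.+-assoc (K * A) t _ ⟨
      (K * A + t) + m * (m * M)    ≡⟨ cong (_+ m * (m * M)) KA+t≡n ⟩
      n + m * (m * M)              <⟨ ℕₚ.+-monoˡ-< (m * (m * M)) n<f[1+k] ⟩
      f (suc k) + m * (m * M)      ≡⟨ ℕₚ.+-assoc (suc k ^ d * A) (m * v) _ ⟩
      suc k ^ d * A + C            ≤⟨ growth k a+C≤k ⟩
      K * (M * suc a ^ d)          ≡⟨ cong (λ z → K * (M * z)) [1+a]^d≡a^d+m ⟩
      K * (M * (a ^ d + m))        ≡⟨ solve 4 (λ K M x m → K :* (M :* (x :+ m)) := K :* (M :* x) :+ K :* M :* m) refl K M (a ^ d) m ⟩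
      K * A + K * M * m            ∎
      where open ℕₚ.≤-Reasoning
    α+βM<KM : α + β * M < K * M
    α+βM<KM = ℕₚ.≤-<-trans (ℕₚ.+-monoʳ-≤ α (ℕₚ.*-monoˡ-≤ M (ℕₚ.<⇒≤ β<m)))
      (ℕₚ.*-cancelʳ-< m (α + m * M) (K * M) (begin-strict
        (α + m * M) * m         ≡⟨ solve 3 (λ α m M → (α :+ m :* M) :* m := α :* m :+ m :* (m :* M)) refl α m M ⟩
        α * m + m * (m * M)     ≤⟨ ℕₚ.+-monoˡ-≤ (m * (m * M)) (subst (α * m ≤_) αm+βv≡t (ℕₚ.m≤m+n (α * m) (β * v))) ⟩
        t + m * (m * M)         <⟨ ℕₚ.+-cancelˡ-< (K * A) _ _ t+mmM<KMm ⟩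
        K * M * m               ∎))
      where open ℕₚ.≤-Reasoning
    β≤K : β ≤ K
    β≤K = proj₁ (split-bound α β K M α+βM<KM)
    α≤[K∸β]M : α ≤ (K ∸ β) * M
    α≤[K∸β]M = proj₂ (split-bound α β K M α+βM<KM)
    count : β * (A + v) + ((K ∸ β) * A + α * m) ≡ n
    count = begin
      β * (A + v) + ((K ∸ β) * A + α * m)  ≡⟨ solve 6 (λ b g A v α m → b :* (A :+ v) :+ (g :* A :+ α :* m) := (b :+ g) :* A :+ (α :* m :+ b :* v)) refl β (K ∸ β) A v α m ⟩
      (β + (K ∸ β)) * A + (α * m + β * v)  ≡⟨ cong₂ (λ x y → x * A + y) (ℕₚ.m+[n∸m]≡n β≤K) αm+βv≡t ⟩
      K * A + t                            ≡⟨ KA+t≡n ⟩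
      n                                    ∎
      where open ≡-Reasoning

  k≤f[k] : ∀ k → k ≤ f k
  k≤f[k] zero        = z≤n
  k≤f[k] k@(suc _)   = begin
    k              ≤⟨ ℕₚ.m≤m*n k (k ^ d₁) {{ℕₚ.m^n≢0 k d₁}} ⟩
    k ^ d          ≤⟨ ℕₚ.m≤m*n (k ^ d) A {{ℕₚ.m*n≢0 M (a ^ d) {{ℕₚ.m^n≢0 m d}} {{ℕₚ.m^n≢0 a d}}}} ⟩
    k ^ d * A      ≤⟨ ℕₚ.m≤m+n (k ^ d * A) (m * v) ⟩
    f k            ∎
    where open ℕₚ.≤-Reasoning

  representation : ∀ n → n₀ ≤ n → ∃ λ k₀ → Representation (suc k₀) n
  representation n n₀≤n with last-satisfying (λ k → f k ≤? n) (suc n) n₀≤n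
                               (ℕₚ.<⇒≱ (ℕₚ.≤-trans (ℕₚ.m≤n+m (suc n) (a + C)) (k≤f[k] (a + C + suc n))))
  ... | suc k₀ , a+C≤k , fk≤n , fk+1≰n = k₀ , representation-in-bracket a+C≤k fk≤n (ℕₚ.≰⇒> fk+1≰n)

sum-replicate : ∀ n x → sum (replicate n x) ≡ n * x
sum-replicate zero    x = refl
sum-replicate (suc n) x = cong (x +_) (sum-replicate n x)

module _ {d : ℕ} where

  unitCubes : ℕ → List (List (Cube d))
  unitCubes g = replicate (suc g ^ d) (unitCube ∷ [])

  uniformGrid : ℕ → List (Cube d)
  uniformGrid g = grid g (unitCubes g)

  uniformGrid-isTiling : ∀ g → IsTiling (uniformGrid g)
  uniformGrid-isTiling g = grid-isTiling g (unitCubes g) (Listₚ.length-replicate (suc g ^ d)) (Allₚ.replicate⁺ (suc g ^ d) unitCube-isTiling)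

  length-uniformGrid : ∀ g → length (uniformGrid g) ≡ suc g ^ d
  length-uniformGrid g = begin
    length (uniformGrid g)                                   ≡⟨ length-grid g (unitCubes g) (Listₚ.length-replicate (suc g ^ d)) ⟩
    sum (map length (replicate (suc g ^ d) (unitCube ∷ [])))  ≡⟨ cong sum (Listₚ.map-replicate length (suc g ^ d) (unitCube ∷ [])) ⟩
    sum (replicate (suc g ^ d) 1)                             ≡⟨ sum-replicate (suc g ^ d) 1 ⟩
    suc g ^ d * 1                                             ≡⟨ ℕₚ.*-identityʳ (suc g ^ d) ⟩
    suc g ^ d                                                 ∎
    where open ≡-Reasoning

  uniformGrid-sidesIn : ∀ g → SidesIn (1/[1+ g ] *ℚ 1ℚ ∷ []) (uniformGrid g)
  uniformGrid-sidesIn g = grid-sidesIn g (unitCubes g) (Allₚ.replicate⁺ (suc g ^ d) (here refl ∷ []))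

distribute : (cap N α : ℕ) → List ℕ
distribute cap zero    α = []
distribute cap (suc N) α = α ⊓ cap ∷ distribute cap N (α ∸ cap)

length-distribute : ∀ cap N α → length (distribute cap N α) ≡ N
length-distribute cap zero    α = refl
length-distribute cap (suc N) α = cong suc (length-distribute cap N (α ∸ cap))

sum-distribute : ∀ cap N α → α ≤ N * cap → sum (distribute cap N α) ≡ α
sum-distribute cap zero    α α≤0 = sym (ℕₚ.n≤0⇒n≡0 α≤0)
sum-distribute cap (suc N) α α≤cap+N*cap = begin
  α ⊓ cap + sum (distribute cap N (α ∸ cap))  ≡⟨ cong (α ⊓ cap +_) (sum-distribute cap N (α ∸ cap) α∸cap≤N*cap) ⟩
  α ⊓ cap + (α ∸ cap)                         ≡⟨ cong (_+ (α ∸ cap)) (ℕₚ.⊓-comm α cap) ⟩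
  cap ⊓ α + (α ∸ cap)                         ≡⟨ ℕₚ.m⊓n+n∸m≡n cap α ⟩
  α                                           ∎
  where
  open ≡-Reasoning
  α∸cap≤N*cap : α ∸ cap ≤ N * cap
  α∸cap≤N*cap = subst (α ∸ cap ≤_) (ℕₚ.m+n∸m≡n cap (N * cap)) (ℕₚ.∸-monoˡ-≤ cap α≤cap+N*cap)

distribute-≤ : ∀ cap N α → All (_≤ cap) (distribute cap N α)
distribute-≤ cap zero    α = []
distribute-≤ cap (suc N) α = ℕₚ.m⊓n≤n α cap ∷ distribute-≤ cap N (α ∸ cap)

sum-map-affine : ∀ {P : ℕ → Set} (f : ℕ → ℕ) c k → (∀ {x} → P x → f x ≡ c + x * k) →
  ∀ {xs} → All P xs → sum (map f xs) ≡ length xs * c + sum xs * k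
sum-map-affine f c k f≡ {[]}     []         = refl
sum-map-affine f c k f≡ {x ∷ xs} (px ∷ pxs) = begin
  f x + sum (map f xs)                            ≡⟨ cong₂ _+_ (f≡ px) (sum-map-affine f c k f≡ pxs) ⟩
  (c + x * k) + (length xs * c + sum xs * k)
    ≡⟨ solve 5 (λ c x k l s → (c :+ x :* k) :+ (l :* c :+ s :* k) := (c :+ l :* c) :+ (x :+ s) :* k) refl c x k (length xs) (sum xs) ⟩
  (c + length xs * c) + (x + sum xs) * k          ∎
  where
  open ≡-Reasoning
  open ℕ-Solver.+-*-Solver

nth : List ℚ → ℕ → ℚ
nth []       _       = 0ℚ
nth (σ ∷ _)  zero    = σ
nth (_ ∷ σs) (suc i) = nth σs i

nth-toℕ : ∀ σs (i : Fin (length σs)) → nth σs (toℕ i) ≡ List.lookup σs i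
nth-toℕ (σ ∷ σs) Fin.zero    = refl
nth-toℕ (σ ∷ σs) (Fin.suc i) = nth-toℕ σs i

atMostSides-fromList : ∀ {d n k} {T : Fin n → Cube d} (σs : List ℚ) → length σs ≤ k →
  (∀ j → side (T j) ∈ σs) → AtMostSides k T
atMostSides-fromList {T = T} σs len≤k sides = (λ a → nth σs (toℕ a)) , λ j →
  Fin.inject≤ (Any.index (sides j)) len≤k , (begin
    side (T j)                                             ≡⟨ Anyₚ.lookup-index (sides j) ⟩
    List.lookup σs (Any.index (sides j))                   ≡⟨ nth-toℕ σs (Any.index (sides j)) ⟨
    nth σs (toℕ (Any.index (sides j)))                     ≡⟨ cong (nth σs) (Finₚ.toℕ-inject≤ (Any.index (sides j)) len≤k) ⟨
    nth σs (toℕ (Fin.inject≤ (Any.index (sides j)) len≤k)) ∎)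
  where open ≡-Reasoning

ReciprocalIn : ℕ → ℕ → ℚ → Set
ReciprocalIn lo hi σ = ∃ λ p → lo ≤ suc p × suc p ≤ hi × σ ≡ 1/[1+ p ]

reciprocalIn-unit : ∀ g → ReciprocalIn (suc g) (suc g) (1/[1+ g ] *ℚ 1ℚ)
reciprocalIn-unit g = g , ℕₚ.≤-refl , ℕₚ.≤-refl , ℚₚ.*-identityʳ 1/[1+ g ]

reciprocalIn-scale : ∀ g {lo hi σ} → ReciprocalIn lo hi σ → ReciprocalIn (suc g * lo) (suc g * hi) (1/[1+ g ] *ℚ σ)
reciprocalIn-scale g (p , lo≤p+1 , p+1≤hi , refl) =
  p + g * suc p , ℕₚ.*-monoʳ-≤ (suc g) lo≤p+1 , ℕₚ.*-monoʳ-≤ (suc g) p+1≤hi , 1/[1+]-* refl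

reciprocalIn-weaken : ∀ {lo lo′ hi hi′ σ} → lo′ ≤ lo → hi ≤ hi′ → ReciprocalIn lo hi σ → ReciprocalIn lo′ hi′ σ
reciprocalIn-weaken lo′≤lo hi≤hi′ (p , lo≤p+1 , p+1≤hi , σ≡) = p , ℕₚ.≤-trans lo′≤lo lo≤p+1 , ℕₚ.≤-trans p+1≤hi hi≤hi′ , σ≡

ratioBounded-fromReciprocals : ∀ {d n lo hi} ε {T : Fin n → Cube d} → 0ℚ ≤ℚ ε →
  fromℕ hi ≤ℚ (1ℚ +ℚ ε) *ℚ fromℕ lo → (∀ j → ReciprocalIn lo hi (side (T j))) → RatioBounded ε T
ratioBounded-fromReciprocals {lo = lo} {hi} ε 0≤ε hi≤[1+ε]lo reciprocal j k
  with reciprocal j | reciprocal k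
... | p , lo≤p+1 , _ , side≡p | q , _ , q+1≤hi , side≡q = subst₂ (λ x y → x ≤ℚ (1ℚ +ℚ ε) *ℚ y) (sym side≡p) (sym side≡q)
  (1/[1+]-≤-scaled p q (1ℚ +ℚ ε) (begin
    fromℕ (suc q)               ≤⟨ fromℕ-mono-≤ q+1≤hi ⟩
    fromℕ hi                    ≤⟨ hi≤[1+ε]lo ⟩
    (1ℚ +ℚ ε) *ℚ fromℕ lo       ≤⟨ ℚₚ.*-monoˡ-≤-nonNeg (1ℚ +ℚ ε) {{1+ε≥0}} (fromℕ-mono-≤ lo≤p+1) ⟩
    (1ℚ +ℚ ε) *ℚ fromℕ (suc p)  ∎))
  where
  open ℚₚ.≤-Reasoning
  1+ε≥0 : ℚ.NonNegative (1ℚ +ℚ ε)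
  1+ε≥0 = ℚ.nonNegative (ℚₚ.+-mono-≤ (ℚₚ.<⇒≤ (ℚₚ.positive⁻¹ 1ℚ)) 0≤ε)

fromℕ-[1+a]≤ : ∀ N a₀ ε → 1/[1+ a₀ ] ≤ℚ ε → fromℕ (N * suc (suc a₀)) ≤ℚ (1ℚ +ℚ ε) *ℚ fromℕ (N * suc a₀)
fromℕ-[1+a]≤ N a₀ ε 1/a≤ε = begin
  fromℕ (N * suc a)                      ≡⟨ cong fromℕ (trans (ℕₚ.*-suc N a) (ℕₚ.+-comm N (N * a))) ⟩
  fromℕ (N * a + N)                      ≡⟨ fromℕ-+ (N * a) N ⟩
  fromℕ (N * a) +ℚ fromℕ N               ≤⟨ ℚₚ.+-monoʳ-≤ (fromℕ (N * a)) N≤εNa ⟩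
  fromℕ (N * a) +ℚ ε *ℚ fromℕ (N * a)    ≡⟨ solve 2 (λ x e → x :+ e :* x := (con 1ℚ :+ e) :* x) refl (fromℕ (N * a)) ε ⟩
  (1ℚ +ℚ ε) *ℚ fromℕ (N * a)             ∎
  where
  open ℚₚ.≤-Reasoning
  open ℚ-Solver.+-*-Solver
  a = suc a₀
  N≤εNa : fromℕ N ≤ℚ ε *ℚ fromℕ (N * a)
  N≤εNa = begin
    fromℕ N                              ≡⟨ ℚₚ.*-identityʳ (fromℕ N) ⟨
    fromℕ N *ℚ 1ℚ                        ≡⟨ cong (fromℕ N *ℚ_) (1/[1+]-inverse a₀) ⟨
    fromℕ N *ℚ (1/[1+ a₀ ] *ℚ fromℕ a)   ≤⟨ ℚₚ.*-monoˡ-≤-nonNeg (fromℕ N) (ℚₚ.*-monoʳ-≤-nonNeg (fromℕ a) 1/a≤ε) ⟩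
    fromℕ N *ℚ (ε *ℚ fromℕ a)            ≡⟨ solve 3 (λ n e a → n :* (e :* a) := e :* (n :* a)) refl (fromℕ N) ε (fromℕ a) ⟩
    ε *ℚ (fromℕ N *ℚ fromℕ a)            ≡⟨ cong (ε *ℚ_) (fromℕ-* N a) ⟨
    ε *ℚ fromℕ (N * a)                   ∎

module Construction (d₁ a₀ : ℕ) (ε : ℚ) (1/a≤ε : 1/[1+ a₀ ] ≤ℚ ε) where

  open Counting d₁ a₀

  subcell : ℕ → List (Cube d)
  subcell b = uniformGrid (b + a₀)

  mixedCell : ℕ → List (Cube d)
  mixedCell j = grid m₀ (map subcell (distribute 1 M j))

  fineCell : List (Cube d)
  fineCell = uniformGrid (m * a)

  cells : ℕ → ℕ → ℕ → List (List (Cube d))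
  cells β γ α = replicate β fineCell ++ map mixedCell (distribute M γ α)

  tiling : ℕ → ℕ → ℕ → ℕ → List (Cube d)
  tiling k₀ β γ α = grid k₀ (cells β γ α)

  length-subcells : ∀ j → length (map subcell (distribute 1 M j)) ≡ suc m₀ ^ d
  length-subcells j = trans (Listₚ.length-map subcell (distribute 1 M j)) (length-distribute 1 M j)

  length-cells : ∀ {k₀} β γ α → β + γ ≡ suc k₀ ^ d → length (cells β γ α) ≡ suc k₀ ^ d
  length-cells {k₀} β γ α β+γ≡ = begin
    length (replicate β fineCell ++ map mixedCell (distribute M γ α))                 ≡⟨ Listₚ.length-++ (replicate β fineCell) ⟩
    length (replicate β fineCell) + length (map mixedCell (distribute M γ α))
      ≡⟨ cong₂ _+_ (Listₚ.length-replicate β) (trans (Listₚ.length-map mixedCell (distribute M γ α)) (length-distribute M γ α)) ⟩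
    β + γ                                                                             ≡⟨ β+γ≡ ⟩
    suc k₀ ^ d                                                                        ∎
    where open ≡-Reasoning

  tiling-isTiling : ∀ k₀ β γ α → β + γ ≡ suc k₀ ^ d → IsTiling (tiling k₀ β γ α)
  tiling-isTiling k₀ β γ α β+γ≡ = grid-isTiling k₀ (cells β γ α) (length-cells β γ α β+γ≡)
    (Allₚ.++⁺ (Allₚ.replicate⁺ β (uniformGrid-isTiling (m * a)))
              (Allₚ.map⁺ (All.universal (λ j → grid-isTiling m₀ _ (length-subcells j)
                 (Allₚ.map⁺ (All.universal (λ b → uniformGrid-isTiling (b + a₀)) _))) _)))

  length-subcell : ∀ {b} → b ≤ 1 → length (subcell b) ≡ a ^ d + b * m
  length-subcell {zero}  _         = trans (length-uniformGrid {d = d} a₀) (sym (ℕₚ.+-identityʳ (a ^ d)))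
  length-subcell {suc zero} _      = trans (length-uniformGrid {d = d} a) (trans [1+a]^d≡a^d+m (cong (a ^ d +_) (sym (ℕₚ.*-identityˡ m))))
  length-subcell {suc (suc _)} (s≤s ())

  length-mixedCell : ∀ {j} → j ≤ M → length (mixedCell j) ≡ A + j * m
  length-mixedCell {j} j≤M = begin
    length (mixedCell j)                              ≡⟨ length-grid m₀ (map subcell ds) (length-subcells j) ⟩
    sum (map length (map subcell ds))                 ≡⟨ cong sum (Listₚ.map-∘ ds) ⟨
    sum (map (λ b → length (subcell b)) ds)           ≡⟨ sum-map-affine _ (a ^ d) m length-subcell (distribute-≤ 1 M j) ⟩
    length ds * a ^ d + sum ds * m
      ≡⟨ cong₂ (λ x y → x * a ^ d + y * m) (length-distribute 1 M j) (sum-distribute 1 M j (subst (j ≤_) (sym (ℕₚ.*-identityʳ M)) j≤M)) ⟩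
    A + j * m                                         ∎
    where
    open ≡-Reasoning
    ds = distribute 1 M j

  length-fineCell : length fineCell ≡ A + v
  length-fineCell = trans (length-uniformGrid {d = d} (m * a)) [1+ma]^d≡A+v

  length-tiling : ∀ k₀ β γ α → β + γ ≡ suc k₀ ^ d → α ≤ γ * M →
    length (tiling k₀ β γ α) ≡ β * (A + v) + (γ * A + α * m)
  length-tiling k₀ β γ α β+γ≡ α≤γM = begin
    length (tiling k₀ β γ α)                                                  ≡⟨ length-grid k₀ (cells β γ α) (length-cells β γ α β+γ≡) ⟩
    sum (map length (replicate β fineCell ++ map mixedCell ds))               ≡⟨ cong sum (Listₚ.map-++ length (replicate β fineCell) (map mixedCell ds)) ⟩
    sum (map length (replicate β fineCell) ++ map length (map mixedCell ds))  ≡⟨ Sumₚ.sum-++ (map length (replicate β fineCell)) _ ⟩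
    sum (map length (replicate β fineCell)) + sum (map length (map mixedCell ds))
      ≡⟨ cong₂ _+_ fineCells mixedCells ⟩
    β * (A + v) + (γ * A + α * m)                                             ∎
    where
    open ≡-Reasoning
    ds = distribute M γ α
    fineCells : sum (map length (replicate β fineCell)) ≡ β * (A + v)
    fineCells = begin
      sum (map length (replicate β fineCell))   ≡⟨ cong sum (Listₚ.map-replicate length β fineCell) ⟩
      sum (replicate β (length fineCell))       ≡⟨ sum-replicate β (length fineCell) ⟩
      β * length fineCell                       ≡⟨ cong (β *_) length-fineCell ⟩
      β * (A + v)                               ∎
    mixedCells : sum (map length (map mixedCell ds)) ≡ γ * A + α * m
    mixedCells = begin
      sum (map length (map mixedCell ds))        ≡⟨ cong sum (Listₚ.map-∘ ds) ⟨
      sum (map (λ j → length (mixedCell j)) ds)  ≡⟨ sum-map-affine _ A m length-mixedCell (distribute-≤ M γ α) ⟩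
      length ds * A + sum ds * m                 ≡⟨ cong₂ (λ x y → x * A + y * m) (length-distribute M γ α) (sum-distribute M γ α α≤γM) ⟩
      γ * A + α * m                              ∎

  subcellSides cellSides : List ℚ
  subcellSides = 1/[1+ a₀ ] *ℚ 1ℚ ∷ 1/[1+ a ] *ℚ 1ℚ ∷ []
  cellSides    = 1/[1+ m * a ] *ℚ 1ℚ ∷ map (1/[1+ m₀ ] *ℚ_) subcellSides

  subcell-sidesIn : ∀ {b} → b ≤ 1 → SidesIn subcellSides (subcell b)
  subcell-sidesIn {zero}        _        = All.map (λ { (here refl) → here refl }) (uniformGrid-sidesIn a₀)
  subcell-sidesIn {suc zero}    _        = All.map (λ { (here refl) → there (here refl) }) (uniformGrid-sidesIn a)
  subcell-sidesIn {suc (suc _)} (s≤s ())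

  tiling-sidesIn : ∀ k₀ β γ α → SidesIn (map (1/[1+ k₀ ] *ℚ_) cellSides) (tiling k₀ β γ α)
  tiling-sidesIn k₀ β γ α = grid-sidesIn k₀ (cells β γ α) (Allₚ.++⁺
    (Allₚ.replicate⁺ β (All.map (λ { (here refl) → here refl }) (uniformGrid-sidesIn (m * a))))
    (Allₚ.map⁺ (All.universal (λ j → All.map there
      (grid-sidesIn m₀ (map subcell (distribute 1 M j)) (Allₚ.map⁺ (All.map subcell-sidesIn (distribute-≤ 1 M j))))) _)))

  cellSides-reciprocalIn : All (ReciprocalIn (m * a) (m * suc a)) cellSides
  cellSides-reciprocalIn =
    reciprocalIn-weaken (ℕₚ.n≤1+n (m * a)) (subst (suc (m * a) ≤_) (sym (ℕₚ.*-suc m a)) (ℕₚ.+-monoˡ-≤ (m * a) (s≤s z≤n)))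
      (reciprocalIn-unit (m * a)) ∷
    reciprocalIn-weaken ℕₚ.≤-refl (ℕₚ.*-monoʳ-≤ m (ℕₚ.n≤1+n a)) (reciprocalIn-scale m₀ (reciprocalIn-unit a₀)) ∷
    reciprocalIn-weaken (ℕₚ.*-monoʳ-≤ m (ℕₚ.n≤1+n a)) ℕₚ.≤-refl (reciprocalIn-scale m₀ (reciprocalIn-unit a)) ∷
    []

  Decomposition : ℕ → Set
  Decomposition n = Σ (Fin n → Cube d) λ T → IsDecomposition T × RatioBounded ε T × AtMostSides (d + 2) T

  tiling-decomposition : ∀ k₀ β γ α → β + γ ≡ suc k₀ ^ d → Decomposition (length (tiling k₀ β γ α))
  tiling-decomposition k₀ β γ α β+γ≡ =
    List.lookup P ,
    isTiling⇒isDecomposition (tiling-isTiling k₀ β γ α β+γ≡) ,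
    ratioBounded-fromReciprocals {lo = k * (m * a)} {k * (m * suc a)} ε {List.lookup P} 0≤ε hi≤[1+ε]lo (λ j → All.lookup reciprocals (sides j)) ,
    atMostSides-fromList {T = List.lookup P} σs (s≤s (ℕₚ.m≤n+m 2 d₁)) sides
    where
    P  = tiling k₀ β γ α
    σs = map (1/[1+ k₀ ] *ℚ_) cellSides
    k  = suc k₀
    sides : ∀ j → side (List.lookup P j) ∈ σs
    sides j = All.lookup (tiling-sidesIn k₀ β γ α) (∈ₚ.∈-lookup j)
    reciprocals : All (ReciprocalIn (k * (m * a)) (k * (m * suc a))) σs
    reciprocals = Allₚ.map⁺ (All.map (reciprocalIn-scale k₀) cellSides-reciprocalIn)
    0≤ε : 0ℚ ≤ℚ ε
    0≤ε = ℚₚ.≤-trans (ℚₚ.nonNegative⁻¹ 1/[1+ a₀ ]) 1/a≤ε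
    hi≤[1+ε]lo : fromℕ (k * (m * suc a)) ≤ℚ (1ℚ +ℚ ε) *ℚ fromℕ (k * (m * a))
    hi≤[1+ε]lo = subst₂ (λ x y → fromℕ x ≤ℚ (1ℚ +ℚ ε) *ℚ fromℕ y) (ℕₚ.*-assoc k m (suc a)) (ℕₚ.*-assoc k m a)
      (fromℕ-[1+a]≤ (k * m) a₀ ε 1/a≤ε)

  decomposition : ∀ n → n₀ ≤ n → Decomposition n
  decomposition n n₀≤n =
    let k₀ , β , γ , α , β+γ≡ , α≤γM , count≡n = representation n n₀≤n
    in subst Decomposition (trans (length-tiling k₀ β γ α β+γ≡ α≤γM) count≡n) (tiling-decomposition k₀ β γ α β+γ≡)

-- The hypothesis 2 ≤ d only serves to exclude d = 0: the construction works for every d ≥ 1.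
theorem2 : (d : ℕ) → 2 ≤ d → (ε : ℚ) → 0ℚ <ℚ ε →
    ∃ λ (n₀ : ℕ) → (n : ℕ) → n₀ ≤ n →
    Σ (Fin n → Cube d) λ T →
    IsDecomposition T × RatioBounded ε T × AtMostSides (d + 2) T
theorem2 zero () ε ε>0
theorem2 (suc d₁) _ ε ε>0 =
  let a₀ , 1/a≤ε = archimedean ε ε>0
  in Counting.n₀ d₁ a₀ , Construction.decomposition d₁ a₀ ε 1/a≤ε
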